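{- Let $\mathbb{K}$ be a field and let $\mathsf{W}_1\subseteq\mathbb{K}^{n_1}\otimes\cdots\otimes\mathbb{K}^{n_d}$ and $\mathsf{W}_2\subseteq\mathbb{K}^{m_1}\otimes\cdots\otimes\mathbb{K}^{m_d}$ be linear subspaces. Then \[ \mathrm{SR}_{\mathbb{K}}(\mathsf{W}_1\oplus\mathsf{W}_2)=\mathrm{SR}_{\mathbb{K}}(\mathsf{W}_1)+\mathrm{SR}_{\mathbb{K}}(\mathsf{W}_2). \]
   Context: For a linear subspace $\mathsf{W}\subseteq\mathbb{K}^{n_1}\otimes\cdots\otimes\mathbb{K}^{n_d}$, $\mathrm{SR}_{\mathbb{K}}(\mathsf{W})=\min\{\sum_{i=1}^d\operatorname{codim}(\mathsf{U}_i):\mathsf{U}_i\subseteq(\mathbb{K}^{n_i})^*,\ \langle T,u_1\otimes\cdots\otimes u_d\rangle=0\ \forall T\in\mathsf{W},u_i\in\mathsf{U}_i\}$, where $\langle T,u_1\otimes\cdots\otimes u_d\rangle$ is full contraction. Writing $\mathbb{K}^{n_i+m_i}=\mathbb{K}^{n_i}\oplus\mathbb{K}^{m_i}$, the direct sum $T\oplus S$ of $T\in\bigotimes\mathbb{K}^{n_i}$ and $S\in\bigotimes\mathbb{K}^{m_i}$ is the block-diagonal tensor in $\bigotimes\mathbb{K}^{n_i+m_i}$, and $\mathsf{W}_1\oplus\mathsf{W}_2=\{T\oplus S: T\in\mathsf{W}_1,S\in\mathsf{W}_2\}$. -}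

module Defs where

open import Level using (Level; _⊔_) renaming (suc to lsuc)
open import Data.Nat using (ℕ; zero; suc; _+_; _∸_; _≤_)
open import Data.Fin using (Fin; zero; suc; splitAt)
open import Data.Sum using (_⊎_; inj₁; inj₂)
open import Data.Maybe using (Maybe; just; nothing)
open import Data.Product using (Σ; _×_; _,_)
open import Relation.Nullary using (¬_)
open import Relation.Binary.PropositionalEquality using (_≡_)
open import Algebra.Bundles using (CommutativeRing)
import Algebra.Properties.Monoid.Sum as MonoidSum

record Field (c ℓ : Level) : Set (lsuc (c ⊔ ℓ)) where
  field
    commutativeRing : CommutativeRing c ℓ
  open CommutativeRing commutativeRing public
  field
    0≉1     : ¬ (0# ≈ 1#)
    inverse : ∀ x → ¬ (x ≈ 0#) → Σ Carrier (λ y → x * y ≈ 1#)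

sumℕ : ∀ {d} → (Fin d → ℕ) → ℕ
sumℕ {zero}  f = 0
sumℕ {suc d} f = f zero + sumℕ (λ i → f (suc i))

Idx : ∀ {d} → (Fin d → ℕ) → Set
Idx {d} n = (i : Fin d) → Fin (n i)

consIdx : ∀ {d} {n : Fin (suc d) → ℕ} → Fin (n zero) → Idx (λ i → n (suc i)) → Idx n
consIdx j r zero    = j
consIdx j r (suc i) = r i

-- the index of K^{n_i + m_i} = K^{n_i} ⊕ K^{m_i}, if all components lie in the first block
toLeft : ∀ {d} (n m : Fin d → ℕ) → Idx (λ i → n i + m i) → Maybe (Idx n)
toLeft {zero}  n m ι = just (λ ())
toLeft {suc d} n m ι with splitAt (n zero) (ι zero) | toLeft (λ i → n (suc i)) (λ i → m (suc i)) (λ i → ι (suc i))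
... | inj₁ a | just r = just (consIdx a r)
... | inj₁ a | nothing = nothing
... | inj₂ b | _ = nothing

toRight : ∀ {d} (n m : Fin d → ℕ) → Idx (λ i → n i + m i) → Maybe (Idx m)
toRight {zero}  n m ι = just (λ ())
toRight {suc d} n m ι with splitAt (n zero) (ι zero) | toRight (λ i → n (suc i)) (λ i → m (suc i)) (λ i → ι (suc i))
... | inj₂ b | just r = just (consIdx b r)
... | inj₂ b | nothing = nothing
... | inj₁ a | _ = nothing

module FieldDefs {c ℓ : Level} (F : Field c ℓ) where
  open Field F using (Carrier; _≈_; 0#; 1#; +-monoid) renaming (_+_ to _+K_; _*_ to _*K_)
  open MonoidSum +-monoid using (sum)

  -- tensors in K^{n_1} ⊗ ... ⊗ K^{n_d}, in coordinates
  Tensor : ∀ {d} → (Fin d → ℕ) → Set c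
  Tensor n = Idx n → Carrier

  -- vectors of K^k (and dual vectors, via the standard dual basis)
  Vec : ℕ → Set c
  Vec k = Fin k → Carrier

  sumIdx : ∀ {d} (n : Fin d → ℕ) → (Idx n → Carrier) → Carrier
  sumIdx {zero}  n f = f (λ ())
  sumIdx {suc d} n f = sum (λ j → sumIdx (λ i → n (suc i)) (λ r → f (consIdx j r)))

  prod : ∀ {d} → (Fin d → Carrier) → Carrier
  prod {zero}  f = 1#
  prod {suc d} f = f zero *K prod (λ i → f (suc i))

  contract : ∀ {d} {n : Fin d → ℕ} → Tensor n → ((i : Fin d) → Vec (n i)) → Carrier
  contract {n = n} T u = sumIdx n (λ ι → T ι *K prod (λ i → u i (ι i)))

  record IsSubspace {p} {d} {n : Fin d → ℕ} (W : Tensor n → Set p) : Set (c ⊔ ℓ ⊔ p) where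
    field
      resp  : ∀ {T S} → (∀ ι → T ι ≈ S ι) → W T → W S
      zero∈ : W (λ _ → 0#)
      +∈    : ∀ {T S} → W T → W S → W (λ ι → T ι +K S ι)
      *∈    : ∀ a {T} → W T → W (λ ι → a *K T ι)

  _⊕T_ : ∀ {d} {n m : Fin d → ℕ} → Tensor n → Tensor m → Tensor (λ i → n i + m i)
  _⊕T_ {n = n} {m} T S ι with toLeft n m ι | toRight n m ι
  ... | just a  | _       = T a
  ... | nothing | just b  = S b
  ... | nothing | nothing = 0#

  _⊕W_ : ∀ {p q} {d} {n m : Fin d → ℕ} → (Tensor n → Set p) → (Tensor m → Set q)
       → Tensor (λ i → n i + m i) → Set (c ⊔ ℓ ⊔ p ⊔ q)
  _⊕W_ {n = n} {m} W₁ W₂ X =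
    Σ (Tensor n) λ T → Σ (Tensor m) λ S → W₁ T × W₂ S × (∀ ι → X ι ≈ (T ⊕T S) ι)

  lincomb : ∀ {k N} → (Fin k → Carrier) → (Fin k → Vec N) → Vec N
  lincomb a B x = sum (λ j → a j *K B j x)

  InSpan : ∀ {k N} → (Fin k → Vec N) → Vec N → Set (c ⊔ ℓ)
  InSpan {k} B u = Σ (Fin k → Carrier) λ a → ∀ x → u x ≈ lincomb a B x

  LinIndep : ∀ {k N} → (Fin k → Vec N) → Set (c ⊔ ℓ)
  LinIndep {k} B = ∀ (a : Fin k → Carrier) → (∀ x → lincomb a B x ≈ 0#) → ∀ j → a j ≈ 0#

  -- A feasible tuple (U_1,...,U_d) of subspaces U_i ⊆ (K^{n_i})^*, each given by
  -- a basis B_i of size k_i (so codim U_i = n_i - k_i), such that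
  -- ⟨T, u_1⊗...⊗u_d⟩ = 0 for all T ∈ W and u_i ∈ U_i.
  record Annihilating {p} {d} {n : Fin d → ℕ} (W : Tensor n → Set p) : Set (c ⊔ ℓ ⊔ p) where
    field
      k      : Fin d → ℕ
      basis  : (i : Fin d) → Fin (k i) → Vec (n i)
      indep  : ∀ i → LinIndep (basis i)
      annih  : ∀ T → W T → ∀ (u : (i : Fin d) → Vec (n i)) → (∀ i → InSpan (basis i) (u i))
             → contract T u ≈ 0#

  codimSum : ∀ {p} {d} {n : Fin d → ℕ} {W : Tensor n → Set p} → Annihilating W → ℕ
  codimSum {n = n} A = sumℕ (λ i → n i ∸ Annihilating.k A i)

  -- SR_K(W) = r : r is the minimum of Σ codim U_i over feasible tuples
  IsSR : ∀ {p} {d} {n : Fin d → ℕ} → (Tensor n → Set p) → ℕ → Set (c ⊔ ℓ ⊔ p)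
  IsSR W r = Σ (Annihilating W) (λ A → codimSum A ≡ r) × (∀ (A : Annihilating W) → r ≤ codimSum A)

-- If (U¹ᵢ) is feasible for W₁ and (U²ᵢ) for W₂, the block-diagonal tuple (U¹ᵢ ⊕ U²ᵢ) is feasible
-- for W₁ ⊕ W₂, since for d ≥ 1 the contraction splits as ⟨T ⊕ S, u⟩ = ⟨T, u|₁⟩ + ⟨S, u|₂⟩, where u|₁
-- and u|₂ are the restrictions of u to the two blocks; codimensions add, which gives ≤.
-- Conversely, if (Uᵢ) is feasible for W₁ ⊕ W₂, then testing against T ⊕ 0 and 0 ⊕ S shows that the
-- restrictions Uᵢ|₁ and (Uᵢ ∩ {u : u|₁ = 0})|₂ are feasible for W₁ and W₂, and by rank–nullity for
-- u ↦ u|₁ their dimensions add up to dim Uᵢ.  Bases of both are obtained by Gaussian elimination on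
-- a basis of Uᵢ.  Elimination has to decide whether field elements are zero, which is available
-- only under a double negation; that suffices because the final inequality on ℕ is decidable.

{-# OPTIONS --safe #-}
module Submission where

open import Defs
open import Level using (Level; _⊔_)
open import Function using (_∘_)
open import Data.Nat as ℕ using (ℕ; zero; suc; _∸_; _≤_; z≤n; s≤s)
import Data.Nat.Properties as ℕ
open import Data.Fin as Fin using (Fin; zero; suc; splitAt; _↑ˡ_; _↑ʳ_)
import Data.Fin.Properties as Fin
open import Data.Vec.Functional using (_∷_; tail; take; drop; map; replicate; _++_)
open import Data.Maybe using (just; nothing; maybe′)
open import Data.Product using (Σ; _×_; _,_; proj₁; proj₂; map₁)
open import Data.Sum using (_⊎_; inj₁; inj₂; [_,_])
open import Data.Empty using (⊥; ⊥-elim)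
open import Relation.Unary using (Pred; _⊆_; _∩_)
open import Relation.Nullary using (¬_; Dec; yes; no)
open import Relation.Nullary.Decidable using (decidable-stable; ¬¬-excluded-middle)
open import Relation.Nullary.Negation using (¬¬-Monad; ¬¬-map)
open import Relation.Binary.PropositionalEquality as ≡ using (_≡_; _≢_)
open import Effect.Monad using (RawMonad)

↑-elim : ∀ {p a b} (P : Fin (a ℕ.+ b) → Set p) → (∀ s → P (s ↑ˡ b)) → (∀ t → P (a ↑ʳ t)) → ∀ z → P z
↑-elim {a = a} {b} P onLeft onRight z =
  ≡.subst P (Fin.join-splitAt a b z) ([_,_] {C = P ∘ Fin.join a b} onLeft onRight (splitAt a z))

sumℕ-cong : ∀ {d} {f g : Fin d → ℕ} → (∀ i → f i ≡ g i) → sumℕ f ≡ sumℕ g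
sumℕ-cong {zero}  f≡g = ≡.refl
sumℕ-cong {suc d} f≡g = ≡.cong₂ ℕ._+_ (f≡g zero) (sumℕ-cong (f≡g ∘ suc))

sumℕ-+ : ∀ {d} (f g : Fin d → ℕ) → sumℕ (λ i → f i ℕ.+ g i) ≡ sumℕ f ℕ.+ sumℕ g
sumℕ-+ {zero}  f g = ≡.refl
sumℕ-+ {suc d} f g = ≡.trans (≡.cong (f zero ℕ.+ g zero ℕ.+_) (sumℕ-+ (tail f) (tail g)))
                             (+-interchange (f zero) (g zero) (sumℕ (tail f)) (sumℕ (tail g)))
  where open import Algebra.Properties.CommutativeSemigroup ℕ.+-commutativeSemigroup
          using () renaming (interchange to +-interchange)

sumℕ-mono-≤ : ∀ {d} {f g : Fin d → ℕ} → (∀ i → f i ≤ g i) → sumℕ f ≤ sumℕ g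
sumℕ-mono-≤ {zero}  f≤g = z≤n
sumℕ-mono-≤ {suc d} f≤g = ℕ.+-mono-≤ (f≤g zero) (sumℕ-mono-≤ (f≤g ∘ suc))

[m+n]∸[o+p]≡[m∸o]+[n∸p] : ∀ m n {o p} → o ≤ m → p ≤ n → (m ℕ.+ n) ∸ (o ℕ.+ p) ≡ (m ∸ o) ℕ.+ (n ∸ p)
[m+n]∸[o+p]≡[m∸o]+[n∸p] m n {o} {p} o≤m p≤n = begin
  (m ℕ.+ n) ∸ (o ℕ.+ p)   ≡⟨ ℕ.∸-+-assoc (m ℕ.+ n) o p ⟨
  (m ℕ.+ n) ∸ o ∸ p       ≡⟨ ≡.cong (_∸ p) (ℕ.+-∸-comm n o≤m) ⟩
  (m ∸ o ℕ.+ n) ∸ p       ≡⟨ ℕ.+-∸-assoc (m ∸ o) p≤n ⟩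
  (m ∸ o) ℕ.+ (n ∸ p)     ∎
  where open ≡.≡-Reasoning

module Sums {c ℓ} (F : Field c ℓ) where
  open Field F hiding (zero)
  open import Algebra.Properties.Semiring.Sum semiring public
    using (sum; sum-cong-≋; sum-replicate-zero; sum-remove; ∑-distrib-+; *-distribˡ-sum)
  open import Relation.Binary.Reasoning.Setoid setoid

  sum-zero : ∀ {k} {f : Fin k → Carrier} → (∀ j → f j ≈ 0#) → sum f ≈ 0#
  sum-zero {k} f≈0 = trans (sum-cong-≋ f≈0) (sum-replicate-zero k)

  sum-delta : ∀ {k} (f : Fin k → Carrier) j → (∀ j' → j' ≢ j → f j' ≈ 0#) → sum f ≈ f j
  sum-delta {suc k} f j off = begin
    sum f                          ≈⟨ sum-remove f ⟩
    f j + sum (f ∘ Fin.punchIn j)  ≈⟨ +-congˡ (sum-zero (λ j' → off _ (Fin.punchInᵢ≢i j j'))) ⟩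
    f j + 0#                       ≈⟨ +-identityʳ (f j) ⟩
    f j                            ∎

  sum-split : ∀ a {b} (f : Fin (a ℕ.+ b) → Carrier) → sum f ≈ sum (take a f) + sum (drop a f)
  sum-split zero    f = sym (+-identityˡ (sum f))
  sum-split (suc a) f = trans (+-congˡ (sum-split a (tail f))) (sym (+-assoc _ _ _))

module LinearAlgebra {c ℓ} (F : Field c ℓ) where
  open Field F hiding (zero)
  open FieldDefs F
  open Sums F
  open import Algebra.Properties.Ring ring using (-1*x≈-x)
  open import Algebra.Properties.Group +-group using (//-rightDividesˡ; ε⁻¹≈ε)
  open import Relation.Binary.Reasoning.Setoid setoid

  x-y*z≈x : ∀ x y {z} → z ≈ 0# → x - y * z ≈ x
  x-y*z≈x x y {z} z≈0 = begin
    x - y * z  ≈⟨ +-congˡ (-‿cong (trans (*-congˡ z≈0) (zeroʳ y))) ⟩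
    x - 0#     ≈⟨ +-congˡ ε⁻¹≈ε ⟩
    x + 0#     ≈⟨ +-identityʳ x ⟩
    x          ∎

  record IsVecSubspace {p} {N} (P : Pred (Vec N) p) : Set (c ⊔ ℓ ⊔ p) where
    field
      resp  : ∀ {u v} → (∀ x → u x ≈ v x) → P u → P v
      zero∈ : P (λ _ → 0#)
      +∈    : ∀ {u v} → P u → P v → P (λ x → u x + v x)
      *∈    : ∀ a {u} → P u → P (λ x → a * u x)

    -∈ : ∀ {u v} → P u → P v → P (λ x → u x - v x)
    -∈ u∈P v∈P = +∈ u∈P (resp (λ x → -1*x≈-x _) (*∈ (- 1#) v∈P))

    lincomb∈ : ∀ {k} (α : Fin k → Carrier) {X : Fin k → Vec N} → (∀ j → P (X j)) → P (lincomb α X)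
    lincomb∈ {zero}  α X∈P = zero∈
    lincomb∈ {suc k} α X∈P = +∈ (*∈ (α zero) (X∈P zero)) (lincomb∈ (tail α) (X∈P ∘ suc))

  InSpan-isVecSubspace : ∀ {k N} (B : Fin k → Vec N) → IsVecSubspace (InSpan B)
  InSpan-isVecSubspace B = record { resp = resp ; zero∈ = zero∈ ; +∈ = +∈ ; *∈ = *∈ }
    where
    resp : ∀ {u v} → (∀ x → u x ≈ v x) → InSpan B u → InSpan B v
    resp u≈v (α , u≈) = α , λ x → trans (sym (u≈v x)) (u≈ x)

    zero∈ : InSpan B (λ _ → 0#)
    zero∈ = (λ _ → 0#) , λ x → sym (sum-zero (λ j → zeroˡ (B j x)))

    +∈ : ∀ {u v} → InSpan B u → InSpan B v → InSpan B (λ x → u x + v x)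
    +∈ {u} {v} (α , u≈) (β , v≈) = (λ j → α j + β j) , λ x → begin
      u x + v x                                         ≈⟨ +-cong (u≈ x) (v≈ x) ⟩
      lincomb α B x + lincomb β B x                     ≈⟨ ∑-distrib-+ (λ j → α j * B j x) (λ j → β j * B j x) ⟨
      sum (λ j → α j * B j x + β j * B j x)             ≈⟨ sum-cong-≋ (λ j → distribʳ (B j x) (α j) (β j)) ⟨
      lincomb (λ j → α j + β j) B x                     ∎

    *∈ : ∀ a {u} → InSpan B u → InSpan B (λ x → a * u x)
    *∈ a {u} (α , u≈) = (λ j → a * α j) , λ x → begin
      a * u x                                           ≈⟨ *-congˡ (u≈ x) ⟩
      a * lincomb α B x                                 ≈⟨ *-distribˡ-sum a (λ j → α j * B j x) ⟩
      sum (λ j → a * (α j * B j x))                     ≈⟨ sum-cong-≋ (λ j → *-assoc a (α j) (B j x)) ⟨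
      lincomb (λ j → a * α j) B x                       ∎

  VanishesOn : ∀ {n N} → (Fin n → Fin N) → Pred (Vec N) ℓ
  VanishesOn ι v = ∀ s → v (ι s) ≈ 0#

  VanishesOn-isVecSubspace : ∀ {n N} (ι : Fin n → Fin N) → IsVecSubspace (VanishesOn ι)
  VanishesOn-isVecSubspace ι = record
    { resp  = λ u≈v u≈0 s → trans (sym (u≈v _)) (u≈0 s)
    ; zero∈ = λ s → refl
    ; +∈    = λ u≈0 v≈0 s → trans (+-cong (u≈0 s) (v≈0 s)) (+-identityˡ 0#)
    ; *∈    = λ a u≈0 s → trans (*-congˡ (u≈0 s)) (zeroʳ a)
    }

  ∩-isVecSubspace : ∀ {p q N} {P : Pred (Vec N) p} {Q : Pred (Vec N) q} →
                    IsVecSubspace P → IsVecSubspace Q → IsVecSubspace (P ∩ Q)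
  ∩-isVecSubspace P-sub Q-sub = record
    { resp  = λ u≈v (u∈P , u∈Q) → P.resp u≈v u∈P , Q.resp u≈v u∈Q
    ; zero∈ = P.zero∈ , Q.zero∈
    ; +∈    = λ (u∈P , u∈Q) (v∈P , v∈Q) → P.+∈ u∈P v∈P , Q.+∈ u∈Q v∈Q
    ; *∈    = λ a (u∈P , u∈Q) → P.*∈ a u∈P , Q.*∈ a u∈Q
    }
    where
    module P = IsVecSubspace P-sub
    module Q = IsVecSubspace Q-sub

  module _ {k N} (B : Fin (suc k) → Vec N) where

    InSpan-tail : InSpan (tail B) ⊆ InSpan B
    InSpan-tail (α , u≈) = (0# ∷ α) , λ x → trans (u≈ x) (sym (trans (+-congʳ (zeroˡ _)) (+-identityˡ _)))

    InSpan-head : InSpan B (B zero)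
    InSpan-head = (1# ∷ λ _ → 0#) , λ x →
      sym (trans (+-cong (*-identityˡ (B zero x)) (sum-zero (λ j → zeroˡ (B (suc j) x)))) (+-identityʳ _))

    LinIndep-tail : LinIndep B → LinIndep (tail B)
    LinIndep-tail indep α α≈0 j =
      indep (0# ∷ α) (λ x → trans (+-cong (zeroˡ _) (α≈0 x)) (+-identityˡ 0#)) (suc j)

    LinIndep⇒head∉InSpan-tail : LinIndep B → ¬ InSpan (tail B) (B zero)
    LinIndep⇒head∉InSpan-tail indep (α , B₀≈) = 0≉1 (sym 1≈0)
      where
      relation : ∀ x → lincomb (- 1# ∷ α) B x ≈ 0#
      relation x = trans (+-cong (-1*x≈-x _) (sym (B₀≈ x))) (-‿inverseˡ _)
      1≈0 : 1# ≈ 0#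
      1≈0 = begin
        1#       ≈⟨ +-identityʳ 1# ⟨
        1# + 0#  ≈⟨ +-congˡ (indep (- 1# ∷ α) relation zero) ⟨
        1# - 1#  ≈⟨ -‿inverseʳ 1# ⟩
        0#       ∎

  InSpan-restriction : ∀ {k k′ a N} {B : Fin k → Vec N} {κ : Fin a → Fin N} (E : Fin k′ → Vec N) →
                       (∀ j → InSpan B (E j)) → ∀ {u} → InSpan (λ j → E j ∘ κ) u →
                       Σ (Vec N) λ ũ → InSpan B ũ × (∀ s → u s ≈ ũ (κ s))
  InSpan-restriction {B = B} E E∈span (α , u≈) =
    lincomb α E , IsVecSubspace.lincomb∈ (InSpan-isVecSubspace B) α E∈span , u≈

  record Echelon {n N p} (ι : Fin n → Fin N) (P : Pred (Vec N) p) : Set (c ⊔ ℓ ⊔ p) where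
    field
      size        : ℕ
      vec         : Fin size → Vec N
      pivot       : Fin size → Fin n
      own-pivot   : ∀ j → vec j (ι (pivot j)) ≈ 1#
      other-pivot : ∀ {j j'} → j ≢ j' → vec j (ι (pivot j')) ≈ 0#
      vec∈P       : ∀ j → P (vec j)

    size≤ : size ≤ n
    size≤ = Fin.injective⇒≤ pivot-injective
      where
      pivot-injective : ∀ {j j'} → pivot j ≡ pivot j' → j ≡ j'
      pivot-injective {j} {j'} pj≡pj' with j Fin.≟ j'
      ... | yes j≡j' = j≡j'
      ... | no  j≢j' = ⊥-elim (0≉1 (begin
        0#                   ≈⟨ other-pivot j≢j' ⟨
        vec j (ι (pivot j')) ≡⟨ ≡.cong (vec j ∘ ι) pj≡pj' ⟨
        vec j (ι (pivot j))  ≈⟨ own-pivot j ⟩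
        1#                   ∎))

    lincomb-at-pivot : ∀ α j → lincomb α vec (ι (pivot j)) ≈ α j
    lincomb-at-pivot α j = begin
      sum (λ j' → α j' * vec j' (ι (pivot j)))  ≈⟨ sum-delta _ j off-diagonal ⟩
      α j * vec j (ι (pivot j))                 ≈⟨ *-congˡ (own-pivot j) ⟩
      α j * 1#                                  ≈⟨ *-identityʳ (α j) ⟩
      α j                                       ∎
      where
      off-diagonal : ∀ j' → j' ≢ j → α j' * vec j' (ι (pivot j)) ≈ 0#
      off-diagonal j' j'≢j = trans (*-congˡ (other-pivot j'≢j)) (zeroʳ (α j'))

    restriction-indep : LinIndep (λ j s → vec j (ι s))
    restriction-indep α α≈0 j = trans (sym (lincomb-at-pivot α j)) (α≈0 (pivot j))

    pivot-coords : Vec N → Fin size → Carrier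
    pivot-coords v j = v (ι (pivot j))

    reduce : Vec N → Vec N
    reduce v x = v x - lincomb (pivot-coords v) vec x

    reduce-at-pivot : ∀ v j → reduce v (ι (pivot j)) ≈ 0#
    reduce-at-pivot v j = trans (+-congˡ (-‿cong (lincomb-at-pivot (pivot-coords v) j))) (-‿inverseʳ _)

    reduce-+ : ∀ v x → reduce v x + lincomb (pivot-coords v) vec x ≈ v x
    reduce-+ v x = //-rightDividesˡ _ (v x)

    reduce∈ : IsVecSubspace P → ∀ {v} → P v → P (reduce v)
    reduce∈ P-sub v∈P = -∈ v∈P (lincomb∈ _ vec∈P)
      where open IsVecSubspace P-sub

  module _ {n N p} {ι : Fin n → Fin N} {P : Pred (Vec N) p} where

    Echelon-empty : Echelon ι P
    Echelon-empty = record
      { size = 0 ; vec = λ () ; pivot = λ () ; own-pivot = λ ()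
      ; other-pivot = λ {j} → ⊥-elim (Fin.¬Fin0 j) ; vec∈P = λ () }

    Echelon-weaken : ∀ {q} {Q : Pred (Vec N) q} → P ⊆ Q → Echelon ι P → Echelon ι Q
    Echelon-weaken P⊆Q E = record { Echelon E ; vec∈P = P⊆Q ∘ Echelon.vec∈P E }

    Echelon-insert : IsVecSubspace P → (E : Echelon ι P) (v : Vec N) → P v →
                     (∀ j → v (ι (Echelon.pivot E j)) ≈ 0#) →
                     (t : Fin n) (y : Carrier) → v (ι t) * y ≈ 1# → Echelon ι P
    Echelon-insert P-sub E v v∈P v-pivots t y vy≈1 = record
      { size        = suc size
      ; vec         = vec′
      ; pivot       = t ∷ pivot
      ; own-pivot   = own-pivot′
      ; other-pivot = other-pivot′
      ; vec∈P       = vec′∈P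
      }
      where
      open Echelon E
      open IsVecSubspace P-sub

      w : Vec N
      w x = y * v x

      w-pivots : ∀ j → w (ι (pivot j)) ≈ 0#
      w-pivots j = trans (*-congˡ (v-pivots j)) (zeroʳ y)

      w-t : w (ι t) ≈ 1#
      w-t = trans (*-comm y _) vy≈1

      vec′ : Fin (suc size) → Vec N
      vec′ = w ∷ λ j x → vec j x - vec j (ι t) * w x

      own-pivot′ : ∀ j → vec′ j (ι ((t ∷ pivot) j)) ≈ 1#
      own-pivot′ zero    = w-t
      own-pivot′ (suc j) = trans (x-y*z≈x _ _ (w-pivots j)) (own-pivot j)

      other-pivot′ : ∀ {j j'} → j ≢ j' → vec′ j (ι ((t ∷ pivot) j')) ≈ 0#
      other-pivot′ {zero}  {zero}   0≢0 = ⊥-elim (0≢0 ≡.refl)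
      other-pivot′ {zero}  {suc j'} _   = w-pivots j'
      other-pivot′ {suc j} {zero}   _   = begin
        vec j (ι t) - vec j (ι t) * w (ι t) ≈⟨ +-congˡ (-‿cong (trans (*-congˡ w-t) (*-identityʳ _))) ⟩
        vec j (ι t) - vec j (ι t)           ≈⟨ -‿inverseʳ _ ⟩
        0#                                  ∎
      other-pivot′ {suc j} {suc j'} j≢j' = trans (x-y*z≈x _ _ (w-pivots j')) (other-pivot (j≢j' ∘ ≡.cong suc))

      vec′∈P : ∀ j → P (vec′ j)
      vec′∈P zero    = *∈ y v∈P
      vec′∈P (suc j) = -∈ (vec∈P j) (*∈ _ (*∈ y v∈P))

  zero-or-invertible-entry : ∀ {n} (v : Fin n → Carrier) →
    ¬ ¬ ((∀ t → v t ≈ 0#) ⊎ Σ (Fin n) λ t → Σ Carrier λ y → v t * y ≈ 1#)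
  zero-or-invertible-entry {n} v = ¬¬-map decide (Fin.sequence ¬¬-applicative (λ t → ¬¬-excluded-middle))
    where
    open RawMonad (¬¬-Monad {ℓ}) using () renaming (rawApplicative to ¬¬-applicative)
    decide : (∀ t → Dec (v t ≈ 0#)) → (∀ t → v t ≈ 0#) ⊎ Σ (Fin n) λ t → Σ Carrier λ y → v t * y ≈ 1#
    decide v? with Fin.all? v?
    ... | yes v≈0 = inj₁ v≈0
    ... | no  v≉0 with Fin.¬∀⟶∃¬ n _ v? v≉0
    ...   | t , vt≉0 = inj₂ (t , inverse (v t) vt≉0)

  module BlockEchelonForm (a b : ℕ) where

    record BlockEchelon {k} (B : Fin k → Vec (a ℕ.+ b)) : Set (c ⊔ ℓ) where
      field
        upper     : Echelon (_↑ˡ b) (InSpan B)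
        lower     : Echelon (a ↑ʳ_) (InSpan B ∩ VanishesOn (_↑ˡ b))
        k≤sizes   : k ≤ Echelon.size upper ℕ.+ Echelon.size lower

    open RawMonad (¬¬-Monad {c ⊔ ℓ}) using (pure; _>>=_)

    blockEchelon-cons : ∀ {k} (B : Fin (suc k) → Vec (a ℕ.+ b)) → LinIndep B →
                        BlockEchelon (tail B) → ¬ ¬ BlockEchelon B
    blockEchelon-cons B indep E = zero-or-invertible-entry (take a v₁) >>= extend-upper
      where
      open BlockEchelon E
      span-sub      = InSpan-isVecSubspace B
      span∩left-sub = ∩-isVecSubspace span-sub (VanishesOn-isVecSubspace (_↑ˡ b))
      module tail-span = IsVecSubspace (InSpan-isVecSubspace (tail B))

      U = Echelon-weaken (InSpan-tail B) upper
      L = Echelon-weaken (map₁ (InSpan-tail B)) lower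
      module U = Echelon U
      module L = Echelon L

      v₁ v₂ : Vec (a ℕ.+ b)
      v₁ = U.reduce (B zero)
      v₂ = L.reduce v₁

      v₁∈span : InSpan B v₁
      v₁∈span = U.reduce∈ span-sub (InSpan-head B)

      head∈span-tail : (∀ x → v₂ x ≈ 0#) → InSpan (tail B) (B zero)
      head∈span-tail v₂≈0 = tail-span.resp head≈
        (tail-span.+∈ (tail-span.lincomb∈ _ (proj₁ ∘ Echelon.vec∈P lower))
                      (tail-span.lincomb∈ _ (Echelon.vec∈P upper)))
        where
        head≈ : ∀ x → lincomb (L.pivot-coords v₁) L.vec x + lincomb (U.pivot-coords (B zero)) U.vec x
                      ≈ B zero x
        head≈ x = begin
          lᴸ + lᵁ            ≈⟨ +-congʳ (+-identityˡ lᴸ) ⟨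
          (0# + lᴸ) + lᵁ     ≈⟨ +-congʳ (+-congʳ (v₂≈0 x)) ⟨
          (v₂ x + lᴸ) + lᵁ   ≈⟨ +-congʳ (L.reduce-+ v₁ x) ⟩
          v₁ x + lᵁ          ≈⟨ U.reduce-+ (B zero) x ⟩
          B zero x           ∎
          where
          lᴸ = lincomb (L.pivot-coords v₁) L.vec x
          lᵁ = lincomb (U.pivot-coords (B zero)) U.vec x

      extend-lower : VanishesOn (_↑ˡ b) v₁ →
                     (∀ t → drop a v₂ t ≈ 0#) ⊎ Σ (Fin b) (λ t → Σ Carrier λ y → drop a v₂ t * y ≈ 1#) →
                     ¬ ¬ BlockEchelon B
      extend-lower v₁-left≈0 (inj₂ (t , y , v₂y≈1)) = pure record
        { upper   = U
        ; lower   = Echelon-insert span∩left-sub L v₂ v₂∈ (L.reduce-at-pivot v₁) t y v₂y≈1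
        ; k≤sizes = ℕ.≤-trans (s≤s k≤sizes) (ℕ.≤-reflexive (≡.sym (ℕ.+-suc U.size L.size)))
        }
        where v₂∈ = L.reduce∈ span∩left-sub (v₁∈span , v₁-left≈0)
      extend-lower v₁-left≈0 (inj₁ v₂-right≈0) =
        ⊥-elim (LinIndep⇒head∉InSpan-tail B indep
                  (head∈span-tail (↑-elim (λ x → v₂ x ≈ 0#) v₂-left≈0 v₂-right≈0)))
        where v₂-left≈0 = proj₂ (L.reduce∈ span∩left-sub (v₁∈span , v₁-left≈0))

      extend-upper : (∀ s → take a v₁ s ≈ 0#) ⊎ Σ (Fin a) (λ s → Σ Carrier λ y → take a v₁ s * y ≈ 1#) →
                     ¬ ¬ BlockEchelon B
      extend-upper (inj₂ (s , y , v₁y≈1)) = pure record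
        { upper   = Echelon-insert span-sub U v₁ v₁∈span (U.reduce-at-pivot (B zero)) s y v₁y≈1
        ; lower   = L
        ; k≤sizes = s≤s k≤sizes
        }
      extend-upper (inj₁ v₁-left≈0) = zero-or-invertible-entry (drop a v₂) >>= extend-lower v₁-left≈0

    blockEchelon : ∀ {k} (B : Fin k → Vec (a ℕ.+ b)) → LinIndep B → ¬ ¬ BlockEchelon B
    blockEchelon {zero}  B _     =
      pure record { upper = Echelon-empty ; lower = Echelon-empty ; k≤sizes = z≤n }
    blockEchelon {suc k} B indep = blockEchelon (tail B) (LinIndep-tail B indep) >>= blockEchelon-cons B indep

  open BlockEchelonForm public using (BlockEchelon; blockEchelon)

  -- Vec (0 + N) is Vec N, so B can be split with an empty first block.
  LinIndep⇒≤ : ∀ {k N} (B : Fin k → Vec N) → LinIndep B → k ≤ N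
  LinIndep⇒≤ {k} {N} B indep = decidable-stable (k ℕ.≤? N) (¬¬-map bound (blockEchelon 0 N B indep))
    where
    bound : BlockEchelon 0 N B → k ≤ N
    bound E = ℕ.≤-trans k≤sizes (ℕ.+-mono-≤ (Echelon.size≤ upper) (Echelon.size≤ lower))
      where open BlockEchelon E

  module _ {k₁ k₂ a b} (B₁ : Fin k₁ → Vec a) (B₂ : Fin k₂ → Vec b) where

    blockDiag : Fin (k₁ ℕ.+ k₂) → Vec (a ℕ.+ b)
    blockDiag = map (_++ replicate b 0#) B₁ ++ map (replicate a 0# ++_) B₂

    blockDiag-↑ˡ-↑ˡ : ∀ x s → blockDiag (x ↑ˡ k₂) (s ↑ˡ b) ≡ B₁ x s
    blockDiag-↑ˡ-↑ˡ x s rewrite Fin.splitAt-↑ˡ k₁ x k₂ | Fin.splitAt-↑ˡ a s b = ≡.refl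

    blockDiag-↑ʳ-↑ˡ : ∀ y s → blockDiag (k₁ ↑ʳ y) (s ↑ˡ b) ≡ 0#
    blockDiag-↑ʳ-↑ˡ y s rewrite Fin.splitAt-↑ʳ k₁ k₂ y | Fin.splitAt-↑ˡ a s b = ≡.refl

    blockDiag-↑ˡ-↑ʳ : ∀ x t → blockDiag (x ↑ˡ k₂) (a ↑ʳ t) ≡ 0#
    blockDiag-↑ˡ-↑ʳ x t rewrite Fin.splitAt-↑ˡ k₁ x k₂ | Fin.splitAt-↑ʳ a b t = ≡.refl

    blockDiag-↑ʳ-↑ʳ : ∀ y t → blockDiag (k₁ ↑ʳ y) (a ↑ʳ t) ≡ B₂ y t
    blockDiag-↑ʳ-↑ʳ y t rewrite Fin.splitAt-↑ʳ k₁ k₂ y | Fin.splitAt-↑ʳ a b t = ≡.refl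

    take-lincomb-blockDiag : ∀ γ s → lincomb γ blockDiag (s ↑ˡ b) ≈ lincomb (take k₁ γ) B₁ s
    take-lincomb-blockDiag γ s = begin
      lincomb γ blockDiag (s ↑ˡ b)                         ≈⟨ sum-split k₁ _ ⟩
      lincomb (take k₁ γ) (take k₁ blockDiag) (s ↑ˡ b)
        + lincomb (drop k₁ γ) (drop k₁ blockDiag) (s ↑ˡ b) ≈⟨ +-cong (sum-cong-≋ on-block) (sum-zero off-block) ⟩
      lincomb (take k₁ γ) B₁ s + 0#                        ≈⟨ +-identityʳ _ ⟩
      lincomb (take k₁ γ) B₁ s                             ∎
      where
      on-block = λ x → *-congˡ (reflexive (blockDiag-↑ˡ-↑ˡ x s))
      off-block = λ y → trans (*-congˡ (reflexive (blockDiag-↑ʳ-↑ˡ y s))) (zeroʳ _)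

    drop-lincomb-blockDiag : ∀ γ t → lincomb γ blockDiag (a ↑ʳ t) ≈ lincomb (drop k₁ γ) B₂ t
    drop-lincomb-blockDiag γ t = begin
      lincomb γ blockDiag (a ↑ʳ t)                         ≈⟨ sum-split k₁ _ ⟩
      lincomb (take k₁ γ) (take k₁ blockDiag) (a ↑ʳ t)
        + lincomb (drop k₁ γ) (drop k₁ blockDiag) (a ↑ʳ t) ≈⟨ +-cong (sum-zero off-block) (sum-cong-≋ on-block) ⟩
      0# + lincomb (drop k₁ γ) B₂ t                        ≈⟨ +-identityˡ _ ⟩
      lincomb (drop k₁ γ) B₂ t                             ∎
      where
      on-block = λ y → *-congˡ (reflexive (blockDiag-↑ʳ-↑ʳ y t))
      off-block = λ x → trans (*-congˡ (reflexive (blockDiag-↑ˡ-↑ʳ x t))) (zeroʳ _)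

    blockDiag-indep : LinIndep B₁ → LinIndep B₂ → LinIndep blockDiag
    blockDiag-indep indep₁ indep₂ γ γ≈0 = ↑-elim (λ j → γ j ≈ 0#)
      (indep₁ (take k₁ γ) (λ s → trans (sym (take-lincomb-blockDiag γ s)) (γ≈0 (s ↑ˡ b))))
      (indep₂ (drop k₁ γ) (λ t → trans (sym (drop-lincomb-blockDiag γ t)) (γ≈0 (a ↑ʳ t))))

    take-InSpan-blockDiag : ∀ {u} → InSpan blockDiag u → InSpan B₁ (take a u)
    take-InSpan-blockDiag (γ , u≈) = take k₁ γ , λ s → trans (u≈ (s ↑ˡ b)) (take-lincomb-blockDiag γ s)

    drop-InSpan-blockDiag : ∀ {u} → InSpan blockDiag u → InSpan B₂ (drop a u)
    drop-InSpan-blockDiag (γ , u≈) = drop k₁ γ , λ t → trans (u≈ (a ↑ʳ t)) (drop-lincomb-blockDiag γ t)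

module Contraction {c ℓ} (F : Field c ℓ) where
  open Field F hiding (zero)
  open FieldDefs F
  open Sums F
  open import Relation.Binary.Reasoning.Setoid setoid

  sumIdx-cong : ∀ {d} (n : Fin d → ℕ) {f g : Idx n → Carrier} → (∀ ι → f ι ≈ g ι) → sumIdx n f ≈ sumIdx n g
  sumIdx-cong {zero}  n f≈g = f≈g _
  sumIdx-cong {suc d} n f≈g = sum-cong-≋ (λ j → sumIdx-cong (tail n) (f≈g ∘ consIdx j))

  sumIdx-zero : ∀ {d} (n : Fin d → ℕ) {f : Idx n → Carrier} → (∀ ι → f ι ≈ 0#) → sumIdx n f ≈ 0#
  sumIdx-zero {zero}  n f≈0 = f≈0 _
  sumIdx-zero {suc d} n f≈0 = sum-zero (λ j → sumIdx-zero (tail n) (f≈0 ∘ consIdx j))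

  sumIdx-+ : ∀ {d} (n : Fin d → ℕ) (f g : Idx n → Carrier) →
             sumIdx n (λ ι → f ι + g ι) ≈ sumIdx n f + sumIdx n g
  sumIdx-+ {zero}  n f g = refl
  sumIdx-+ {suc d} n f g = trans (sum-cong-≋ (λ j → sumIdx-+ (tail n) (f ∘ consIdx j) (g ∘ consIdx j)))
                                 (∑-distrib-+ (λ j → sumIdx (tail n) (f ∘ consIdx j))
                                              (λ j → sumIdx (tail n) (g ∘ consIdx j)))

  prod-cong : ∀ {d} {f g : Fin d → Carrier} → (∀ i → f i ≈ g i) → prod f ≈ prod g
  prod-cong {zero}  f≈g = refl
  prod-cong {suc d} f≈g = *-cong (f≈g zero) (prod-cong (f≈g ∘ suc))

  contract-congˡ : ∀ {d} {n : Fin d → ℕ} {T T′ : Tensor n} (u : (i : Fin d) → Vec (n i)) →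
                   (∀ ι → T ι ≈ T′ ι) → contract T u ≈ contract T′ u
  contract-congˡ {n = n} u T≈T′ = sumIdx-cong n (λ ι → *-congʳ (T≈T′ ι))

  contract-congʳ : ∀ {d} {n : Fin d → ℕ} (T : Tensor n) {u v : (i : Fin d) → Vec (n i)} →
                   (∀ i x → u i x ≈ v i x) → contract T u ≈ contract T v
  contract-congʳ {n = n} T u≈v = sumIdx-cong n (λ ι → *-congˡ (prod-cong (λ i → u≈v i (ι i))))

  contract-zero : ∀ {d} {n : Fin d → ℕ} (u : (i : Fin d) → Vec (n i)) → contract {n = n} (λ _ → 0#) u ≈ 0#
  contract-zero {n = n} u = sumIdx-zero n (λ ι → zeroˡ _)

  toLeft-just : ∀ {d} (n m : Fin d → ℕ) ι {α} → toLeft n m ι ≡ just α → ∀ i → ι i ≡ α i ↑ˡ m i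
  toLeft-just {suc d} n m ι eq i
    with splitAt (n zero) (ι zero) in split≡ | toLeft (tail n) (tail m) (ι ∘ suc) in rest≡
  toLeft-just {suc d} n m ι ≡.refl zero    | inj₁ s | just r = ≡.sym (Fin.splitAt⁻¹-↑ˡ split≡)
  toLeft-just {suc d} n m ι ≡.refl (suc i) | inj₁ s | just r = toLeft-just (tail n) (tail m) (ι ∘ suc) rest≡ i

  toRight-just : ∀ {d} (n m : Fin d → ℕ) ι {β} → toRight n m ι ≡ just β → ∀ i → ι i ≡ n i ↑ʳ β i
  toRight-just {suc d} n m ι eq i
    with splitAt (n zero) (ι zero) in split≡ | toRight (tail n) (tail m) (ι ∘ suc) in rest≡
  toRight-just {suc d} n m ι ≡.refl zero    | inj₂ t | just r = ≡.sym (Fin.splitAt⁻¹-↑ʳ split≡)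
  toRight-just {suc d} n m ι ≡.refl (suc i) | inj₂ t | just r = toRight-just (tail n) (tail m) (ι ∘ suc) rest≡ i

  toLeft-toRight-disjoint : ∀ {d} (n m : Fin (suc d) → ℕ) ι {α β} →
                            toLeft n m ι ≡ just α → toRight n m ι ≡ just β → ⊥
  toLeft-toRight-disjoint n m ι eqL eqR
    with splitAt (n zero) (ι zero) | toLeft (tail n) (tail m) (ι ∘ suc) | toRight (tail n) (tail m) (ι ∘ suc)
  toLeft-toRight-disjoint n m ι eqL () | inj₁ _ | _ | _
  toLeft-toRight-disjoint n m ι () eqR | inj₂ _ | _ | _

  sumIdx-toLeft : ∀ {d} (n m : Fin d → ℕ) (f : Idx n → Carrier) →
                  sumIdx (λ i → n i ℕ.+ m i) (λ ι → maybe′ f 0# (toLeft n m ι)) ≈ sumIdx n f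
  sumIdx-toLeft {zero}  n m f = refl
  sumIdx-toLeft {suc d} n m f = begin
    sum (λ z → sumIdx nm′ (λ r → maybe′ f 0# (toLeft n m (consIdx z r))))
      ≈⟨ sum-split (n zero) _ ⟩
    sum (λ s → sumIdx nm′ (λ r → maybe′ f 0# (toLeft n m (consIdx (s ↑ˡ m zero) r))))
      + sum (λ t → sumIdx nm′ (λ r → maybe′ f 0# (toLeft n m (consIdx (n zero ↑ʳ t) r))))
      ≈⟨ +-cong (sum-cong-≋ on-block) (sum-zero off-block) ⟩
    sumIdx n f + 0#
      ≈⟨ +-identityʳ _ ⟩
    sumIdx n f ∎
    where
    nm′ = λ i → n (suc i) ℕ.+ m (suc i)
    cons-↑ˡ : ∀ s r → maybe′ f 0# (toLeft n m (consIdx (s ↑ˡ m zero) r))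
                    ≡ maybe′ (f ∘ consIdx s) 0# (toLeft (tail n) (tail m) r)
    cons-↑ˡ s r rewrite Fin.splitAt-↑ˡ (n zero) s (m zero) with toLeft (tail n) (tail m) r
    ... | just _  = ≡.refl
    ... | nothing = ≡.refl
    cons-↑ʳ : ∀ t r → maybe′ f 0# (toLeft n m (consIdx (n zero ↑ʳ t) r)) ≡ 0#
    cons-↑ʳ t r rewrite Fin.splitAt-↑ʳ (n zero) (m zero) t = ≡.refl
    on-block = λ s → trans (sumIdx-cong nm′ (reflexive ∘ cons-↑ˡ s))
                           (sumIdx-toLeft (tail n) (tail m) (f ∘ consIdx s))
    off-block = λ t → sumIdx-zero nm′ (reflexive ∘ cons-↑ʳ t)

  sumIdx-toRight : ∀ {d} (n m : Fin d → ℕ) (f : Idx m → Carrier) →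
                   sumIdx (λ i → n i ℕ.+ m i) (λ ι → maybe′ f 0# (toRight n m ι)) ≈ sumIdx m f
  sumIdx-toRight {zero}  n m f = refl
  sumIdx-toRight {suc d} n m f = begin
    sum (λ z → sumIdx nm′ (λ r → maybe′ f 0# (toRight n m (consIdx z r))))
      ≈⟨ sum-split (n zero) _ ⟩
    sum (λ s → sumIdx nm′ (λ r → maybe′ f 0# (toRight n m (consIdx (s ↑ˡ m zero) r))))
      + sum (λ t → sumIdx nm′ (λ r → maybe′ f 0# (toRight n m (consIdx (n zero ↑ʳ t) r))))
      ≈⟨ +-cong (sum-zero off-block) (sum-cong-≋ on-block) ⟩
    0# + sumIdx m f
      ≈⟨ +-identityˡ _ ⟩
    sumIdx m f ∎
    where
    nm′ = λ i → n (suc i) ℕ.+ m (suc i)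
    cons-↑ʳ : ∀ t r → maybe′ f 0# (toRight n m (consIdx (n zero ↑ʳ t) r))
                    ≡ maybe′ (f ∘ consIdx t) 0# (toRight (tail n) (tail m) r)
    cons-↑ʳ t r rewrite Fin.splitAt-↑ʳ (n zero) (m zero) t with toRight (tail n) (tail m) r
    ... | just _  = ≡.refl
    ... | nothing = ≡.refl
    cons-↑ˡ : ∀ s r → maybe′ f 0# (toRight n m (consIdx (s ↑ˡ m zero) r)) ≡ 0#
    cons-↑ˡ s r rewrite Fin.splitAt-↑ˡ (n zero) s (m zero) = ≡.refl
    on-block = λ t → trans (sumIdx-cong nm′ (reflexive ∘ cons-↑ʳ t))
                           (sumIdx-toRight (tail n) (tail m) (f ∘ consIdx t))
    off-block = λ s → sumIdx-zero nm′ (reflexive ∘ cons-↑ˡ s)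

  module _ {d} (n m : Fin (suc d) → ℕ) where

    contract-⊕ : ∀ (T : Tensor n) (S : Tensor m) u →
                 contract (T ⊕T S) u ≈ contract T (λ i → take (n i) (u i)) + contract S (λ i → drop (n i) (u i))
    contract-⊕ T S u = begin
      sumIdx nm (λ ι → (T ⊕T S) ι * g ι)
        ≈⟨ sumIdx-cong nm split ⟩
      sumIdx nm (λ ι → maybe′ onLeft 0# (toLeft n m ι) + maybe′ onRight 0# (toRight n m ι))
        ≈⟨ sumIdx-+ nm (maybe′ onLeft 0# ∘ toLeft n m) (maybe′ onRight 0# ∘ toRight n m) ⟩
      sumIdx nm (maybe′ onLeft 0# ∘ toLeft n m) + sumIdx nm (maybe′ onRight 0# ∘ toRight n m)
        ≈⟨ +-cong (sumIdx-toLeft n m onLeft) (sumIdx-toRight n m onRight) ⟩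
      sumIdx n onLeft + sumIdx m onRight
        ∎
      where
      nm = λ i → n i ℕ.+ m i
      g : Idx nm → Carrier
      g ι = prod (λ i → u i (ι i))
      g-cong : ∀ {ι ι′} → (∀ i → ι i ≡ ι′ i) → g ι ≈ g ι′
      g-cong ι≡ι′ = prod-cong (λ i → reflexive (≡.cong (u i) (ι≡ι′ i)))
      onLeft : Idx n → Carrier
      onLeft α = T α * prod (λ i → take (n i) (u i) (α i))
      onRight : Idx m → Carrier
      onRight β = S β * prod (λ i → drop (n i) (u i) (β i))
      split : ∀ ι → (T ⊕T S) ι * g ι ≈ maybe′ onLeft 0# (toLeft n m ι) + maybe′ onRight 0# (toRight n m ι)
      split ι with toLeft n m ι in toLeft≡ | toRight n m ι in toRight≡
      ... | just α  | just β  = ⊥-elim (toLeft-toRight-disjoint n m ι toLeft≡ toRight≡)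
      ... | just α  | nothing = trans (*-congˡ (g-cong (toLeft-just n m ι toLeft≡))) (sym (+-identityʳ _))
      ... | nothing | just β  = trans (*-congˡ (g-cong (toRight-just n m ι toRight≡))) (sym (+-identityˡ _))
      ... | nothing | nothing = trans (zeroˡ _) (sym (+-identityˡ 0#))

    contract-⊕-zeroʳ : ∀ (T : Tensor n) u → contract (T ⊕T (λ _ → 0#)) u ≈ contract T (λ i → take (n i) (u i))
    contract-⊕-zeroʳ T u = trans (contract-⊕ T _ u)
      (trans (+-congˡ (contract-zero (λ i → drop (n i) (u i)))) (+-identityʳ _))

    contract-⊕-zeroˡ : ∀ (S : Tensor m) u → contract ((λ _ → 0#) ⊕T S) u ≈ contract S (λ i → drop (n i) (u i))
    contract-⊕-zeroˡ S u = trans (contract-⊕ _ S u)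
      (trans (+-congʳ (contract-zero (λ i → take (n i) (u i)))) (+-identityˡ _))

module DirectSum {c ℓ} (F : Field c ℓ) {p q d} (n m : Fin (suc d) → ℕ)
                 (W₁ : FieldDefs.Tensor F n → Set p) (W₂ : FieldDefs.Tensor F m → Set q) where
  open Field F hiding (zero)
  open FieldDefs F
  open LinearAlgebra F
  open Contraction F
  open Annihilating
  open import Relation.Binary.Reasoning.Setoid setoid

  ⊕-annihilating : Annihilating W₁ → Annihilating W₂ → Annihilating (W₁ ⊕W W₂)
  ⊕-annihilating A₁ A₂ = record
    { k     = λ i → k A₁ i ℕ.+ k A₂ i
    ; basis = λ i → blockDiag (basis A₁ i) (basis A₂ i)
    ; indep = λ i → blockDiag-indep (basis A₁ i) (basis A₂ i) (indep A₁ i) (indep A₂ i)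
    ; annih = annih′
    }
    where
    annih′ : ∀ X → (W₁ ⊕W W₂) X → ∀ u → (∀ i → InSpan (blockDiag (basis A₁ i) (basis A₂ i)) (u i)) →
             contract X u ≈ 0#
    annih′ X (T , S , T∈W₁ , S∈W₂ , X≈T⊕S) u u∈ = begin
      contract X u                                                            ≈⟨ contract-congˡ u X≈T⊕S ⟩
      contract (T ⊕T S) u                                                     ≈⟨ contract-⊕ n m T S u ⟩
      contract T (λ i → take (n i) (u i)) + contract S (λ i → drop (n i) (u i)) ≈⟨ +-cong annih₁ annih₂ ⟩
      0# + 0#                                                                 ≈⟨ +-identityʳ 0# ⟩
      0#                                                                      ∎
      where
      annih₁ = annih A₁ T T∈W₁ _ (λ i → take-InSpan-blockDiag (basis A₁ i) (basis A₂ i) (u∈ i))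
      annih₂ = annih A₂ S S∈W₂ _ (λ i → drop-InSpan-blockDiag (basis A₁ i) (basis A₂ i) (u∈ i))

  codimSum-⊕ : ∀ A₁ A₂ → codimSum (⊕-annihilating A₁ A₂) ≡ codimSum A₁ ℕ.+ codimSum A₂
  codimSum-⊕ A₁ A₂ = ≡.trans
    (sumℕ-cong (λ i → [m+n]∸[o+p]≡[m∸o]+[n∸p] (n i) (m i)
                         (LinIndep⇒≤ (basis A₁ i) (indep A₁ i)) (LinIndep⇒≤ (basis A₂ i) (indep A₂ i))))
    (sumℕ-+ (λ i → n i ∸ k A₁ i) (λ i → m i ∸ k A₂ i))

  module _ (A : Annihilating (W₁ ⊕W W₂)) where

    restrictˡ : W₂ (λ _ → 0#) → (∀ i → Echelon (_↑ˡ m i) (InSpan (basis A i))) → Annihilating W₁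
    restrictˡ 0∈W₂ E = record
      { k     = λ i → Echelon.size (E i)
      ; basis = λ i j → take (n i) (Echelon.vec (E i) j)
      ; indep = λ i → Echelon.restriction-indep (E i)
      ; annih = annih′
      }
      where
      annih′ : ∀ T → W₁ T → ∀ u → (∀ i → InSpan (λ j → take (n i) (Echelon.vec (E i) j)) (u i)) →
               contract T u ≈ 0#
      annih′ T T∈W₁ u u∈ = begin
        contract T u                          ≈⟨ contract-congʳ T u≈ũ ⟩
        contract T (λ i → take (n i) (ũ i))   ≈⟨ contract-⊕-zeroʳ n m T ũ ⟨
        contract (T ⊕T (λ _ → 0#)) ũ          ≈⟨ annih A _ (T , _ , T∈W₁ , 0∈W₂ , λ _ → refl) ũ ũ∈span ⟩
        0#                                    ∎
        where
        lifted = λ i → InSpan-restriction (Echelon.vec (E i)) (Echelon.vec∈P (E i)) (u∈ i)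
        ũ = λ i → proj₁ (lifted i)
        ũ∈span = λ i → proj₁ (proj₂ (lifted i))
        u≈ũ = λ i → proj₂ (proj₂ (lifted i))

    restrictʳ : W₁ (λ _ → 0#) → (∀ i → Echelon (n i ↑ʳ_) (InSpan (basis A i))) → Annihilating W₂
    restrictʳ 0∈W₁ E = record
      { k     = λ i → Echelon.size (E i)
      ; basis = λ i j → drop (n i) (Echelon.vec (E i) j)
      ; indep = λ i → Echelon.restriction-indep (E i)
      ; annih = annih′
      }
      where
      annih′ : ∀ S → W₂ S → ∀ u → (∀ i → InSpan (λ j → drop (n i) (Echelon.vec (E i) j)) (u i)) →
               contract S u ≈ 0#
      annih′ S S∈W₂ u u∈ = begin
        contract S u                          ≈⟨ contract-congʳ S u≈ũ ⟩
        contract S (λ i → drop (n i) (ũ i))   ≈⟨ contract-⊕-zeroˡ n m S ũ ⟨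
        contract ((λ _ → 0#) ⊕T S) ũ          ≈⟨ annih A _ (_ , S , 0∈W₁ , S∈W₂ , λ _ → refl) ũ ũ∈span ⟩
        0#                                    ∎
        where
        lifted = λ i → InSpan-restriction (Echelon.vec (E i)) (Echelon.vec∈P (E i)) (u∈ i)
        ũ = λ i → proj₁ (lifted i)
        ũ∈span = λ i → proj₁ (proj₂ (lifted i))
        u≈ũ = λ i → proj₂ (proj₂ (lifted i))

    split-annihilating : W₁ (λ _ → 0#) → W₂ (λ _ → 0#) →
      ¬ ¬ Σ (Annihilating W₁) λ A₁ → Σ (Annihilating W₂) λ A₂ → codimSum A₁ ℕ.+ codimSum A₂ ≤ codimSum A
    split-annihilating 0∈W₁ 0∈W₂ =
      ¬¬-map split (Fin.sequence ¬¬-applicative (λ i → blockEchelon (n i) (m i) (basis A i) (indep A i)))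
      where
      open RawMonad (¬¬-Monad {c ⊔ ℓ}) using () renaming (rawApplicative to ¬¬-applicative)
      split : (∀ i → BlockEchelon (n i) (m i) (basis A i)) →
              Σ (Annihilating W₁) λ A₁ → Σ (Annihilating W₂) λ A₂ → codimSum A₁ ℕ.+ codimSum A₂ ≤ codimSum A
      split E = A₁ , A₂ , ≡.subst (_≤ codimSum A) (sumℕ-+ (λ i → n i ∸ k A₁ i) (λ i → m i ∸ k A₂ i))
                                                  (sumℕ-mono-≤ codim≤)
        where
        open BlockEchelon
        A₁ = restrictˡ 0∈W₂ (upper ∘ E)
        A₂ = restrictʳ 0∈W₁ (λ i → Echelon-weaken proj₁ (lower (E i)))
        codim≤ : ∀ i → (n i ∸ k A₁ i) ℕ.+ (m i ∸ k A₂ i) ≤ (n i ℕ.+ m i) ∸ k A i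
        codim≤ i = ≡.subst (_≤ (n i ℕ.+ m i) ∸ k A i)
          ([m+n]∸[o+p]≡[m∸o]+[n∸p] (n i) (m i) (Echelon.size≤ (upper (E i))) (Echelon.size≤ (lower (E i))))
          (ℕ.∸-monoʳ-≤ (n i ℕ.+ m i) (k≤sizes (E i)))

open import Data.Nat using (_+_)

proposition5p9 : ∀ {c ℓ p q : Level} (F : Field c ℓ) (d : ℕ) → 1 ≤ d → (n m : Fin d → ℕ)
                 → (W₁ : FieldDefs.Tensor F n → Set p) → (W₂ : FieldDefs.Tensor F m → Set q)
                 → FieldDefs.IsSubspace F W₁ → FieldDefs.IsSubspace F W₂
                 → (r₁ r₂ : ℕ) → FieldDefs.IsSR F W₁ r₁ → FieldDefs.IsSR F W₂ r₂
                 → FieldDefs.IsSR F (FieldDefs._⊕W_ F W₁ W₂) (r₁ + r₂)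
proposition5p9 F (suc d) (s≤s z≤n) n m W₁ W₂ W₁-sub W₂-sub r₁ r₂
               ((A₁ , A₁≡r₁) , r₁-min) ((A₂ , A₂≡r₂) , r₂-min) =
  (⊕-annihilating A₁ A₂ , ≡.trans (codimSum-⊕ A₁ A₂) (≡.cong₂ _+_ A₁≡r₁ A₂≡r₂)) , minimal
  where
  open FieldDefs F using (IsSubspace; codimSum)
  open DirectSum F n m W₁ W₂

  minimal : ∀ A → r₁ + r₂ ≤ codimSum A
  minimal A = decidable-stable (r₁ + r₂ ℕ.≤? codimSum A) (¬¬-map
    (λ (A₁′ , A₂′ , A₁′+A₂′≤A) → ℕ.≤-trans (ℕ.+-mono-≤ (r₁-min A₁′) (r₂-min A₂′)) A₁′+A₂′≤A)
    (split-annihilating A (IsSubspace.zero∈ W₁-sub) (IsSubspace.zero∈ W₂-sub)))
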